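{- In every c-monoid, for all $x,y$: (1) $d(x\|y)=d(x)\|d(y)$; (2) $d(x)\|d(y)=d(x)\cdot d(y)$; (3) $d(x)\cdot x=x$; (4) $d(x\cdot d(y))=d(x\cdot y)$; (5) $d(d(x)\cdot y)=d(x)\cdot d(y)$; (6) $d(x)\cdot d(y)=d(y)\cdot d(x)$; (7) $d(1_\sigma)=1_\sigma$.
   Context: A proto-monoid is a structure $(S,\cdot,1_\sigma)$ with $1_\sigma\cdot x=x=x\cdot 1_\sigma$ for all $x$ (no associativity required). A proto-bi-monoid is $(S,\cdot,\|,1_\sigma,1_\pi)$ such that $(S,\cdot,1_\sigma)$ is a proto-monoid and $(S,\|,1_\pi)$ is a commutative monoid. A c-monoid is a proto-bi-monoid satisfying, for all $x,y$: (c1) $(x\cdot 1_\pi)\|x=x$; (c2) $((x\cdot 1_\pi)\|1_\sigma)\cdot y=(x\cdot 1_\pi)\|y$; (c3) $(x\|y)\cdot 1_\pi=(x\cdot 1_\pi)\|(y\cdot 1_\pi)$; (c4) $(x\cdot y)\cdot 1_\pi=x\cdot(y\cdot 1_\pi)$; (c5) $1_\sigma\|1_\sigma=1_\sigma$. The domain operation is defined by $d(x)=(x\cdot 1_\pi)\|1_\sigma$. -}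

module Defs where

open import Level using (Level; suc)
open import Relation.Binary.PropositionalEquality using (_≡_)

record CMonoid (a : Level) : Set (suc a) where
  infixl 7 _·_
  infixl 6 _‖_
  field
    S    : Set a
    _·_  : S → S → S
    _‖_  : S → S → S
    1σ   : S
    1π   : S
    -- proto-monoid (S, ·, 1σ): two-sided unit, no associativity
    ·-identityˡ : ∀ x → 1σ · x ≡ x
    ·-identityʳ : ∀ x → x · 1σ ≡ x
    ‖-assoc     : ∀ x y z → (x ‖ y) ‖ z ≡ x ‖ (y ‖ z)
    ‖-comm      : ∀ x y → x ‖ y ≡ y ‖ x
    ‖-identityˡ : ∀ x → 1π ‖ x ≡ x
    ‖-identityʳ : ∀ x → x ‖ 1π ≡ x
    c1 : ∀ x → (x · 1π) ‖ x ≡ x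
    c2 : ∀ x y → ((x · 1π) ‖ 1σ) · y ≡ (x · 1π) ‖ y
    c3 : ∀ x y → (x ‖ y) · 1π ≡ (x · 1π) ‖ (y · 1π)
    c4 : ∀ x y → (x · y) · 1π ≡ x · (y · 1π)
    c5 : 1σ ‖ 1σ ≡ 1σ

  d : S → S
  d x = (x · 1π) ‖ 1σ

module Submission where

open import Defs
open import Level using (Level)
open import Data.Product using (_×_; _,_)
open import Relation.Binary.PropositionalEquality
  using (_≡_; sym; trans; cong; module ≡-Reasoning)

-- Every d x · d y and d x ‖ d y normalises to (x · 1π) ‖ (y · 1π) ‖ 1σ:
-- for the product this is axiom c2, for the parallel composition it is
-- commutativity of ‖ together with the idempotence c5 of 1σ. Everything
-- else follows from c3 and c4, which say that − · 1π commutes with ‖ and ·.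
module DomainProperties {a : Level} (M : CMonoid a) where
  open CMonoid M
  open ≡-Reasoning

  π : S → S
  π x = x · 1π

  π-1π : π 1π ≡ 1π
  π-1π = trans (sym (‖-identityʳ (1π · 1π))) (c1 1π)

  π-idem : ∀ x → π (π x) ≡ π x
  π-idem x = trans (c4 x 1π) (cong (x ·_) π-1π)

  π-d : ∀ x → π (d x) ≡ π x
  π-d x = trans (c2 x 1π) (‖-identityʳ (π x))

  d‖d≡π‖π‖1σ : ∀ x y → d x ‖ d y ≡ π x ‖ π y ‖ 1σ
  d‖d≡π‖π‖1σ x y = begin
    (π x ‖ 1σ) ‖ (π y ‖ 1σ)  ≡⟨ ‖-assoc (π x) 1σ (π y ‖ 1σ) ⟩
    π x ‖ (1σ ‖ (π y ‖ 1σ))  ≡⟨ cong (π x ‖_) (sym (‖-assoc 1σ (π y) 1σ)) ⟩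
    π x ‖ ((1σ ‖ π y) ‖ 1σ)  ≡⟨ cong (λ z → π x ‖ (z ‖ 1σ)) (‖-comm 1σ (π y)) ⟩
    π x ‖ ((π y ‖ 1σ) ‖ 1σ)  ≡⟨ cong (π x ‖_) (‖-assoc (π y) 1σ 1σ) ⟩
    π x ‖ (π y ‖ (1σ ‖ 1σ))  ≡⟨ cong (λ z → π x ‖ (π y ‖ z)) c5 ⟩
    π x ‖ (π y ‖ 1σ)         ≡⟨ sym (‖-assoc (π x) (π y) 1σ) ⟩
    π x ‖ π y ‖ 1σ           ∎

  d·d≡π‖π‖1σ : ∀ x y → d x · d y ≡ π x ‖ π y ‖ 1σ
  d·d≡π‖π‖1σ x y = trans (c2 x (d y)) (sym (‖-assoc (π x) (π y) 1σ))

  d-distrib-‖ : ∀ x y → d (x ‖ y) ≡ d x ‖ d y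
  d-distrib-‖ x y = trans (cong (_‖ 1σ) (c3 x y)) (sym (d‖d≡π‖π‖1σ x y))

  d‖d≡d·d : ∀ x y → d x ‖ d y ≡ d x · d y
  d‖d≡d·d x y = trans (d‖d≡π‖π‖1σ x y) (sym (d·d≡π‖π‖1σ x y))

  d-identityˡ : ∀ x → d x · x ≡ x
  d-identityˡ x = trans (c2 x x) (c1 x)

  d-·-d : ∀ x y → d (x · d y) ≡ d (x · y)
  d-·-d x y = cong (_‖ 1σ) (begin
    (x · d y) · 1π  ≡⟨ c4 x (d y) ⟩
    x · π (d y)     ≡⟨ cong (x ·_) (π-d y) ⟩
    x · π y         ≡⟨ sym (c4 x y) ⟩
    (x · y) · 1π    ∎)

  d-d-· : ∀ x y → d (d x · y) ≡ d x · d y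
  d-d-· x y = begin
    π (d x · y) ‖ 1σ      ≡⟨ cong (λ z → π z ‖ 1σ) (c2 x y) ⟩
    π (π x ‖ y) ‖ 1σ      ≡⟨ cong (_‖ 1σ) (c3 (π x) y) ⟩
    π (π x) ‖ π y ‖ 1σ    ≡⟨ cong (λ z → z ‖ π y ‖ 1σ) (π-idem x) ⟩
    π x ‖ π y ‖ 1σ        ≡⟨ sym (d·d≡π‖π‖1σ x y) ⟩
    d x · d y             ∎

  d·d-comm : ∀ x y → d x · d y ≡ d y · d x
  d·d-comm x y = begin
    d x · d y  ≡⟨ sym (d‖d≡d·d x y) ⟩
    d x ‖ d y  ≡⟨ ‖-comm (d x) (d y) ⟩
    d y ‖ d x  ≡⟨ d‖d≡d·d y x ⟩
    d y · d x  ∎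

  d-1σ : d 1σ ≡ 1σ
  d-1σ = trans (cong (_‖ 1σ) (·-identityˡ 1π)) (‖-identityˡ 1σ)

proposition9 : ∀ {a : Level} (M : CMonoid a) → let open CMonoid M in
    ∀ x y →
      (d (x ‖ y) ≡ d x ‖ d y)
      × (d x ‖ d y ≡ d x · d y)
      × (d x · x ≡ x)
      × (d (x · d y) ≡ d (x · y))
      × (d (d x · y) ≡ d x · d y)
      × (d x · d y ≡ d y · d x)
      × (d 1σ ≡ 1σ)
proposition9 M x y =
  d-distrib-‖ x y , d‖d≡d·d x y , d-identityˡ x , d-·-d x y ,
  d-d-· x y , d·d-comm x y , d-1σ
  where open DomainProperties M
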